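{- A polynomial family $(Q_{n,k})$ (with $Q_{0,0}=1$ and $Q_{m,0}=0$ for $m\ge1$) is B-representable if and only if for all integers $1\le k\le n$, \[Q_{n,k}=\sum_{j=1}^{n-k+1}\binom{n-1}{j-1}Q_{j,1}Q_{n-j,k-1}.\]
   Context: $\mathbb{K}$ is a field of characteristic zero. Partial Bell polynomials: $B_{0,0}=1$, $B_{n,0}=0$ ($n\ge1$), $B_{n,k}=0$ ($k>n$), and for $1\le k\le n$, $B_{n,k}=\sum\frac{n!}{\prod_ir_i!(i!)^{r_i}}\prod_iX_i^{r_i}$ over non-negative integers with $\sum r_i=k$, $\sum ir_i=n$. A family $(Q_{n,k})$ of polynomials over $\mathbb{K}$ is B-representable if there is an infinite sequence of polynomials $H_1,H_2,\ldots$ such that $Q_{n,k}=B_{n,k}(H_1,\ldots,H_{n-k+1})$ (substitution of $H_j$ for $X_j$) for all $1\le k\le n$. -}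

module Defs where

open import Level using (_⊔_)
open import Algebra.Bundles using (CommutativeRing)
open import Data.Nat using (ℕ; zero; suc; _+_; _*_; _∸_; _≤_; _≟_; _<?_; _!)
open import Data.Nat.DivMod using (_/_)
open import Data.Nat.Combinatorics using (_C_)
open import Data.Fin using (Fin; toℕ)
open import Data.Vec using (Vec; []; _∷_)
open import Data.List using (List; []; _∷_; concatMap; upTo)
open import Data.Bool using (Bool; true; false; if_then_else_; _∧_)
open import Data.Product using (Σ)
open import Relation.Nullary.Decidable using (⌊_⌋)

-- natural-number power and exact division (denominator is never 0 where used)
_^ℕ_ : ℕ → ℕ → ℕ
m ^ℕ zero = 1
m ^ℕ suc e = m * (m ^ℕ e)

_div_ : ℕ → ℕ → ℕ
m div zero = 0
m div suc d = m / suc d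

allVecs : (len b : ℕ) → List (Vec ℕ len)
allVecs zero b = [] ∷ []
allVecs (suc len) b =
  concatMap (λ x → Data.List.map (x ∷_) (allVecs len b)) (upTo (suc b))

size : ∀ {len} → Vec ℕ len → ℕ
size [] = 0
size (x ∷ r) = x + size r

weight : ∀ {len} → ℕ → Vec ℕ len → ℕ
weight off [] = 0
weight off (x ∷ r) = off * x + weight (suc off) r

denom : ∀ {len} → ℕ → Vec ℕ len → ℕ
denom off [] = 1
denom off (x ∷ r) = ((x !) * ((off !) ^ℕ x)) * denom (suc off) r

module Bell {c ℓ} (R : CommutativeRing c ℓ) where
  open CommutativeRing R renaming (_+_ to _+ᴿ_; _*_ to _*ᴿ_)

  _·_ : ℕ → Carrier → Carrier
  zero · x = 0#
  suc m · x = x +ᴿ (m · x)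

  _^_ : Carrier → ℕ → Carrier
  x ^ zero = 1#
  x ^ suc e = x *ᴿ (x ^ e)

  mono : ∀ {len} → (ℕ → Carrier) → ℕ → Vec ℕ len → Carrier
  mono X off [] = 1#
  mono X off (x ∷ r) = (X off ^ x) *ᴿ mono X (suc off) r

  sumL : List Carrier → Carrier
  sumL [] = 0#
  sumL (x ∷ xs) = x +ᴿ sumL xs

  sumFromTo : ℕ → ℕ → (ℕ → Carrier) → Carrier
  sumFromTo a b f = sumL (Data.List.map (λ i → f (a + i)) (upTo (suc b ∸ a)))

  -- Partial Bell polynomial B_{n,k} evaluated at X (X i is substituted for X_i, i ≥ 1;
  -- X 0 is never used).  Exponent vectors r = (r_1,…,r_n) with entries ≤ n suffice
  -- since Σ i r_i = n.
  B : ℕ → ℕ → (ℕ → Carrier) → Carrier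
  B zero zero X = 1#
  B (suc n) zero X = 0#
  B n (suc k) X =
    if ⌊ n Data.Nat.<? suc k ⌋ then 0#
    else sumL (Data.List.map term (allVecs n n))
    where
      term : Vec ℕ n → Carrier
      term r =
        if ⌊ size r ≟ suc k ⌋ ∧ ⌊ weight 1 r ≟ n ⌋
        then ((n !) div denom 1 r) · mono X 1 r
        else 0#

  -- B-representable: there is a sequence H_1, H_2, … (H j = H_j; H 0 unused) with
  -- Q_{n,k} = B_{n,k}(H_1,…,H_{n-k+1}) for all 1 ≤ k ≤ n.
  BRepresentable : (ℕ → ℕ → Carrier) → Set (c ⊔ ℓ)
  BRepresentable Q = Σ (ℕ → Carrier) λ H →
    ∀ n k → 1 ≤ k → k ≤ n → Q n k ≈ B n k H

  BellRecurrence : (ℕ → ℕ → Carrier) → Set ℓ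
  BellRecurrence Q = ∀ n k → 1 ≤ k → k ≤ n →
    Q n k ≈ sumFromTo 1 (n ∸ k + 1)
              (λ j → ((n ∸ 1) C (j ∸ 1)) · (Q j 1 *ᴿ Q (n ∸ j) (k ∸ 1)))

-- The coefficient n!/d(r), d(r) = ∏ r_i!(i!)^{r_i}, of X^r in B_{n,k} counts the set partitions
-- of an n-set with r_i blocks of size i. Sorting the partitions of {0,…,n} by the size p+1 of
-- the block containing 0 gives (n+1)!/d(r) = Σ_p C(n,p)·(n−p)!/d(r − e_{p+1}), and summing over
-- the exponent vectors r turns this into B_{n+1,k+1}(X) = Σ_p C(n,p)·X_{p+1}·B_{n−p,k}(X), with
-- B_{n,1}(X) = X_n. Hence every B-representable family satisfies the recurrence, with
-- H_j = Q_{j,1}. Conversely, the recurrence determines Q_{n,k} (1 ≤ k ≤ n) from Q_{·,1} and from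
-- values with smaller first index, so by strong induction on n it forces
-- Q_{n,k} = B_{n,k}(Q_{1,1}, Q_{2,1}, …).
module Submission where

open import Defs
open import Algebra.Bundles using (CommutativeRing; CommutativeSemiring)
open import Data.Nat using (ℕ; zero; suc; _+_; _*_; _∸_; _≤_; _<_; z≤n; s≤s; z<s; _!; _≟_; _<?_; _≤?_)
open import Data.Nat.Properties
open import Data.Nat.Combinatorics using (_C_; nCk≡n!/k![n-k]!; k>n⇒nCk≡0; k![n∸k]!∣n!; nCn≡1)
open import Data.Nat.DivMod using (_/_; m*n/n≡m; m/n*n≡m)
open import Data.Nat.Induction using (<-rec)
open import Data.Nat.Tactic.RingSolver using (solve-∀)
open import Data.Vec using (Vec; []; _∷_; _++_; replicate)
open import Data.Vec.Relation.Unary.Any using (Any; here; there)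
open import Data.List as List using (List; upTo; applyUpTo; concatMap)
open import Data.Product using (_×_; _,_; proj₁; proj₂)
open import Function using (_∘_)
open import Function.Bundles using (_⇔_; mk⇔)
open import Relation.Binary.PropositionalEquality
  using (_≡_; refl; sym; trans; cong; cong₂; subst; subst₂; module ≡-Reasoning)
open import Relation.Nullary using (¬_; yes; no)
open import Relation.Nullary.Decidable using (⌊_⌋; _×-dec_)
open import Data.Bool using (if_then_else_; _∧_)
open import Data.Empty using (⊥-elim)

module FiniteSum {c ℓ} (S : CommutativeSemiring c ℓ) where
  module S = CommutativeSemiring S
  open S using (Carrier; _≈_; 0#; setoid) renaming (_+_ to _⊕_; _*_ to _⊗_)
  open import Relation.Binary.Reasoning.Setoid setoid

  Σ< : ℕ → (ℕ → Carrier) → Carrier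
  Σ< zero    f = 0#
  Σ< (suc n) f = f 0 ⊕ Σ< n (f ∘ suc)

  Σ<-cong< : ∀ n {f g} → (∀ i → i < n → f i ≈ g i) → Σ< n f ≈ Σ< n g
  Σ<-cong< zero    eq = S.refl
  Σ<-cong< (suc n) eq = S.+-cong (eq 0 z<s) (Σ<-cong< n (λ i i<n → eq (suc i) (s≤s i<n)))

  Σ<-cong : ∀ n {f g} → (∀ i → f i ≈ g i) → Σ< n f ≈ Σ< n g
  Σ<-cong n eq = Σ<-cong< n (λ i _ → eq i)

  Σ<-zero : ∀ n {f} → (∀ i → i < n → f i ≈ 0#) → Σ< n f ≈ 0#
  Σ<-zero zero    eq = S.refl
  Σ<-zero (suc n) eq =
    S.trans (S.+-cong (eq 0 z<s) (Σ<-zero n (λ i i<n → eq (suc i) (s≤s i<n)))) (S.+-identityˡ 0#)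

  Σ<-split : ∀ a d f → Σ< (a + d) f ≈ Σ< a f ⊕ Σ< d (λ i → f (a + i))
  Σ<-split zero    d f = S.sym (S.+-identityˡ _)
  Σ<-split (suc a) d f = S.trans (S.+-congˡ (Σ<-split a d (f ∘ suc))) (S.sym (S.+-assoc _ _ _))

  Σ<-last : ∀ n f → Σ< (suc n) f ≈ Σ< n f ⊕ f n
  Σ<-last n f = begin
    Σ< (suc n) f               ≡⟨ cong (λ m → Σ< m f) (+-comm 1 n) ⟩
    Σ< (n + 1) f               ≈⟨ Σ<-split n 1 f ⟩
    Σ< n f ⊕ (f (n + 0) ⊕ 0#)  ≈⟨ S.+-congˡ (S.+-identityʳ _) ⟩
    Σ< n f ⊕ f (n + 0)         ≡⟨ cong (λ m → Σ< n f ⊕ f m) (+-identityʳ n) ⟩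
    Σ< n f ⊕ f n               ∎

  Σ<-distribˡ : ∀ n a f → a ⊗ Σ< n f ≈ Σ< n (λ i → a ⊗ f i)
  Σ<-distribˡ zero    a f = S.zeroʳ a
  Σ<-distribˡ (suc n) a f = S.trans (S.distribˡ a (f 0) _) (S.+-congˡ (Σ<-distribˡ n a (f ∘ suc)))

  Σ<-distribʳ : ∀ n a f → Σ< n f ⊗ a ≈ Σ< n (λ i → f i ⊗ a)
  Σ<-distribʳ n a f =
    S.trans (S.*-comm _ a) (S.trans (Σ<-distribˡ n a f) (Σ<-cong n (λ i → S.*-comm a (f i))))

module ℕ-Sum = FiniteSum +-*-commutativeSemiring

-- Exponent vectors

entry : ∀ {len} → Vec ℕ len → ℕ → ℕ
entry []      p       = 0
entry (x ∷ r) zero    = x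
entry (x ∷ r) (suc p) = entry r p

decrementAt : ∀ {len} → ℕ → Vec ℕ len → Vec ℕ len
decrementAt p       []      = []
decrementAt zero    (x ∷ r) = x ∸ 1 ∷ r
decrementAt (suc p) (x ∷ r) = x ∷ decrementAt p r

atDecrement : ∀ {a} {A : Set a} {len} → A → ℕ → (Vec ℕ len → A) → Vec ℕ len → A
atDecrement z p       h []          = z
atDecrement z zero    h (zero ∷ r)  = z
atDecrement z zero    h (suc x ∷ r) = h (x ∷ r)
atDecrement z (suc p) h (x ∷ r)     = atDecrement z p (h ∘ (x ∷_)) r

module _ {a} {A : Set a} where
  atDecrement-zero : ∀ {len} (z : A) p h (r : Vec ℕ len) → entry r p ≡ 0 → atDecrement z p h r ≡ z
  atDecrement-zero z p       h []          eq = refl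
  atDecrement-zero z zero    h (zero ∷ r)  eq = refl
  atDecrement-zero z (suc p) h (x ∷ r)     eq = atDecrement-zero z p (h ∘ (x ∷_)) r eq

  atDecrement-suc : ∀ {len} (z : A) p h (r : Vec ℕ len) {y} →
                    entry r p ≡ suc y → atDecrement z p h r ≡ h (decrementAt p r)
  atDecrement-suc z zero    h (suc x ∷ r) eq = refl
  atDecrement-suc z (suc p) h (x ∷ r)     eq = atDecrement-suc z p (h ∘ (x ∷_)) r eq

size-decrementAt : ∀ {len} p (r : Vec ℕ len) {y} → entry r p ≡ suc y → size r ≡ suc (size (decrementAt p r))
size-decrementAt zero    (suc x ∷ r) eq = refl
size-decrementAt (suc p) (x ∷ r)     eq = trans (cong (x +_) (size-decrementAt p r eq)) (+-suc x _)

weight-decrementAt : ∀ {len} o p (r : Vec ℕ len) {y} → entry r p ≡ suc y →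
                     weight o r ≡ (p + o) + weight o (decrementAt p r)
weight-decrementAt o zero    (suc x ∷ r) eq = reassoc o x (weight (suc o) r)
  where
    reassoc : ∀ o x w → o * suc x + w ≡ o + (o * x + w)
    reassoc = solve-∀
weight-decrementAt o (suc p) (x ∷ r) eq =
  trans (cong (o * x +_) (weight-decrementAt (suc o) p r eq)) (reassoc (o * x) p o _)
  where
    reassoc : ∀ a p o w → a + ((p + suc o) + w) ≡ (suc p + o) + (a + w)
    reassoc = solve-∀

denom-decrementAt : ∀ {len} o p (r : Vec ℕ len) {y} → entry r p ≡ suc y →
                    denom o r ≡ denom o (decrementAt p r) * (suc y * (p + o) !)
denom-decrementAt o zero (suc x ∷ r) refl = regroup (x !) (o !) ((o !) ^ℕ x) (denom (suc o) r) x
  where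
    regroup : ∀ a q qx d x → ((a + x * a) * (q * qx)) * d ≡ ((a * qx) * d) * (suc x * q)
    regroup = solve-∀
denom-decrementAt o (suc p) (x ∷ r) {y} eq = begin
  c * denom (suc o) r                    ≡⟨ cong (c *_) (denom-decrementAt (suc o) p r eq) ⟩
  c * (d′ * (suc y * (p + suc o) !))     ≡⟨ cong (λ q → c * (d′ * (suc y * q !))) (+-suc p o) ⟩
  c * (d′ * (suc y * (suc p + o) !))     ≡⟨ *-assoc c d′ _ ⟨
  c * d′ * (suc y * (suc p + o) !)       ∎
  where
    open ≡-Reasoning
    c = x ! * (o !) ^ℕ x
    d′ = denom (suc o) (decrementAt p r)

weight≡⇒weight-decrementAt≡ : ∀ {n} p {len} (r : Vec ℕ len) {y} → entry r p ≡ suc y → weight 1 r ≡ suc n →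
                               p ≤ n × weight 1 (decrementAt p r) ≡ n ∸ p
weight≡⇒weight-decrementAt≡ {n} p r eq w = p≤n , sym (trans (cong (_∸ p) n≡) (m+n∸m≡n p _))
  where
    n≡ : n ≡ p + weight 1 (decrementAt p r)
    n≡ = suc-injective (trans (sym w)
           (trans (weight-decrementAt 1 p r eq) (cong (_+ weight 1 (decrementAt p r)) (+-comm p 1))))
    p≤n : p ≤ n
    p≤n = subst (p ≤_) (sym n≡) (m≤m+n p _)

weight-decrementAt≡⇒weight≡ : ∀ {n} p {len} (r : Vec ℕ len) {y} → entry r p ≡ suc y → p ≤ n →
                               weight 1 (decrementAt p r) ≡ n ∸ p → weight 1 r ≡ suc n
weight-decrementAt≡⇒weight≡ {n} p r eq p≤n w =
  trans (weight-decrementAt 1 p r eq) (trans (cong₂ _+_ (+-comm p 1) w) (cong suc (m+[n∸m]≡n p≤n)))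

index*entry≤weight : ∀ {len} o p (r : Vec ℕ len) → (p + o) * entry r p ≤ weight o r
index*entry≤weight o p       []      = ≤-reflexive (*-zeroʳ (p + o))
index*entry≤weight o zero    (x ∷ r) = m≤m+n (o * x) _
index*entry≤weight o (suc p) (x ∷ r) =
  ≤-trans (subst (λ q → q * entry r p ≤ weight (suc o) r) (+-suc p o) (index*entry≤weight (suc o) p r))
          (m≤n+m _ (o * x))

entry≡⇒∸<weight : ∀ {n} p {len} (r : Vec ℕ len) → entry r p ≡ suc n → n ∸ p < weight 1 r
entry≡⇒∸<weight {n} p r eq = begin-strict
  n ∸ p                  ≤⟨ m∸n≤m n p ⟩
  n                      <⟨ n<1+n n ⟩
  suc n                  ≡⟨ *-identityˡ (suc n) ⟨
  1 * suc n              ≤⟨ *-monoˡ-≤ (suc n) (m≤n+m 1 p) ⟩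
  (p + 1) * suc n        ≡⟨ cong ((p + 1) *_) eq ⟨
  (p + 1) * entry r p    ≤⟨ index*entry≤weight 1 p r ⟩
  weight 1 r             ∎
  where open ≤-Reasoning

Σ-index*entry≡weight : ∀ {len} o (r : Vec ℕ len) → ℕ-Sum.Σ< len (λ p → (p + o) * entry r p) ≡ weight o r
Σ-index*entry≡weight o []                = refl
Σ-index*entry≡weight {suc len} o (x ∷ r) = cong (o * x +_) (trans
  (ℕ-Sum.Σ<-cong len (λ p → cong (_* entry r p) (sym (+-suc p o)))) (Σ-index*entry≡weight (suc o) r))

size≤weight : ∀ {len} o (r : Vec ℕ len) → size r ≤ weight (suc o) r
size≤weight o []      = z≤n
size≤weight o (x ∷ r) = +-mono-≤ (≤-trans (m≤m*n x (suc o)) (≤-reflexive (*-comm x (suc o)))) (size≤weight (suc o) r)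

size≡0⇒weight≡0 : ∀ {len} o (r : Vec ℕ len) → size r ≡ 0 → weight o r ≡ 0
size≡0⇒weight≡0 o []         eq = refl
size≡0⇒weight≡0 o (zero ∷ r) eq = trans (cong (_+ weight (suc o) r) (*-zeroʳ o)) (size≡0⇒weight≡0 (suc o) r eq)

any>⇒<weight : ∀ {b len} o {r : Vec ℕ len} → Any (b <_) r → b < weight (suc o) r
any>⇒<weight o {x ∷ r} (here b<x) = ≤-trans b<x (≤-trans (m≤n*m x (suc o)) (m≤m+n _ _))
any>⇒<weight o {x ∷ r} (there e)  = ≤-trans (any>⇒<weight (suc o) e) (m≤n+m _ _)

any>0⇒≤weight : ∀ {len} o {r : Vec ℕ len} → Any (0 <_) r → o ≤ weight o r
any>0⇒≤weight o {suc x ∷ r} (here _) = ≤-trans (m≤m*n o (suc x)) (m≤m+n _ _)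
any>0⇒≤weight o {x ∷ r}     (there e) = ≤-trans (n≤1+n o) (≤-trans (any>0⇒≤weight (suc o) e) (m≤n+m _ _))

size-padding : ∀ {len} d (r : Vec ℕ len) → size (r ++ replicate d 0) ≡ size r
size-padding zero    []      = refl
size-padding (suc d) []      = size-padding d []
size-padding d       (x ∷ r) = cong (x +_) (size-padding d r)

weight-padding : ∀ {len} d o (r : Vec ℕ len) → weight o (r ++ replicate d 0) ≡ weight o r
weight-padding zero    o []      = refl
weight-padding (suc d) o []      =
  trans (cong (_+ weight (suc o) (replicate d 0)) (*-zeroʳ o)) (weight-padding d (suc o) [])
weight-padding d       o (x ∷ r) = cong (o * x +_) (weight-padding d (suc o) r)

denom-padding : ∀ {len} d o (r : Vec ℕ len) → denom o (r ++ replicate d 0) ≡ denom o r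
denom-padding zero    o []      = refl
denom-padding (suc d) o []      = trans (+-identityʳ _) (denom-padding d (suc o) [])
denom-padding d       o (x ∷ r) = cong (x ! * (o !) ^ℕ x *_) (denom-padding d (suc o) r)

weight-++ : ∀ {l₁ l₂} o (r : Vec ℕ l₁) (s : Vec ℕ l₂) → weight o (r ++ s) ≡ weight o r + weight (l₁ + o) s
weight-++ o [] s = refl
weight-++ {suc l₁} o (x ∷ r) s = trans
  (cong (o * x +_) (trans (weight-++ (suc o) r s) (cong (λ q → weight (suc o) r + weight q s) (+-suc l₁ o))))
  (sym (+-assoc (o * x) _ _))

positive-tail⇒<weight : ∀ {m d} (r : Vec ℕ m) (s : Vec ℕ d) → Any (0 <_) s → m < weight 1 (r ++ s)
positive-tail⇒<weight {m} r s pos = begin-strict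
  m                           <⟨ m<m+n m z<s ⟩
  m + 1                       ≤⟨ any>0⇒≤weight (m + 1) pos ⟩
  weight (m + 1) s            ≤⟨ m≤n+m _ (weight 1 r) ⟩
  weight 1 r + weight (m + 1) s ≡⟨ weight-++ 1 r s ⟨
  weight 1 (r ++ s)           ∎
  where open ≤-Reasoning

-- Coefficients of the partial Bell polynomials

^ℕ-positive : ∀ m e → 1 ≤ m → 1 ≤ m ^ℕ e
^ℕ-positive m zero    _   = ≤-refl
^ℕ-positive m (suc e) 1≤m = *-mono-≤ 1≤m (^ℕ-positive m e 1≤m)

denom-positive : ∀ {len} o (r : Vec ℕ len) → 1 ≤ denom o r
denom-positive o []      = ≤-refl
denom-positive o (x ∷ r) = *-mono-≤ (*-mono-≤ (1≤n! x) (^ℕ-positive (o !) x (1≤n! o))) (denom-positive (suc o) r)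

weight≡0⇒denom≡1 : ∀ {len} o (r : Vec ℕ len) → weight (suc o) r ≡ 0 → denom (suc o) r ≡ 1
weight≡0⇒denom≡1 o []         eq = refl
weight≡0⇒denom≡1 o (zero ∷ r) eq =
  trans (+-identityʳ _) (weight≡0⇒denom≡1 (suc o) r (trans (cong (_+ weight (suc (suc o)) r) (sym (*-zeroʳ o))) eq))

*≡⇒div≡ : ∀ q {d n} → q * d ≡ n → 1 ≤ d → n div d ≡ q
*≡⇒div≡ q {suc d} eq _ = trans (cong (_/ suc d) (sym eq)) (m*n/n≡m q (suc d))

nCk*k![n∸k]!≡n! : ∀ {n k} → k ≤ n → (n C k) * (k ! * (n ∸ k) !) ≡ n !
nCk*k![n∸k]!≡n! {n} {k} k≤n =
  trans (cong (_* (k ! * (n ∸ k) !)) (nCk≡n!/k![n-k]! k≤n)) (m/n*n≡m {{k !* (n ∸ k) !≢0}} (k![n∸k]!∣n! k≤n))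

coeff : ℕ → ∀ {len} → Vec ℕ len → ℕ
coeff n r = (n !) div denom 1 r

decrementedCoeff : ℕ → ℕ → ∀ {len} → Vec ℕ len → ℕ
decrementedCoeff n p = atDecrement 0 p (coeff (n ∸ p))

CoeffExact : ℕ → Set
CoeffExact n = ∀ {len} (r : Vec ℕ len) → weight 1 r ≡ n → coeff n r * denom 1 r ≡ n !

nCp*decrementedCoeff*denom : ∀ n → (∀ {m} → m < suc n → CoeffExact m) → ∀ {len} (r : Vec ℕ len) →
  weight 1 r ≡ suc n → ∀ p → (n C p) * decrementedCoeff n p r * denom 1 r ≡ n ! * ((p + 1) * entry r p)
nCp*decrementedCoeff*denom n exact r w p with entry r p in eq
... | zero rewrite atDecrement-zero 0 p (coeff (n ∸ p)) r eq = zeros (n C p) (denom 1 r) (n !) p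
  where
    zeros : ∀ c d f p → c * 0 * d ≡ f * ((p + 1) * 0)
    zeros = solve-∀
... | suc y = begin
  (n C p) * a * denom 1 r                         ≡⟨ cong ((n C p) * a *_) (denom-decrementAt 1 p r eq) ⟩
  (n C p) * a * (d′ * (suc y * (p + 1) !))        ≡⟨ cong (λ q → (n C p) * a * (d′ * (suc y * q !))) (+-comm p 1) ⟩
  (n C p) * a * (d′ * (suc y * (suc p) !))        ≡⟨ regroup (n C p) a d′ y p (p !) ⟩
  (n C p) * (p ! * (a * d′)) * ((p + 1) * suc y)  ≡⟨ cong (λ q → (n C p) * (p ! * q) * ((p + 1) * suc y)) a*denom ⟩
  (n C p) * (p ! * (n ∸ p) !) * ((p + 1) * suc y) ≡⟨ cong (_* ((p + 1) * suc y)) (nCk*k![n∸k]!≡n! p≤n) ⟩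
  n ! * ((p + 1) * suc y)                         ∎
  where
    open ≡-Reasoning
    r′ = decrementAt p r
    d′ = denom 1 r′
    a = decrementedCoeff n p r
    regroup : ∀ c a d y p f → c * a * (d * (suc y * (suc p * f))) ≡ c * (f * (a * d)) * ((p + 1) * suc y)
    regroup = solve-∀
    p≤n : p ≤ n
    p≤n = proj₁ (weight≡⇒weight-decrementAt≡ p r eq w)
    a*denom : a * d′ ≡ (n ∸ p) !
    a*denom = trans (cong (_* d′) (atDecrement-suc 0 p (coeff (n ∸ p)) r eq))
                    (exact (s≤s (m∸n≤m n p)) r′ (proj₂ (weight≡⇒weight-decrementAt≡ p r eq w)))

Σ-nCp*decrementedCoeff*denom : ∀ n → (∀ {m} → m < suc n → CoeffExact m) → ∀ {len} (r : Vec ℕ len) →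
  weight 1 r ≡ suc n → ℕ-Sum.Σ< len (λ p → (n C p) * decrementedCoeff n p r) * denom 1 r ≡ suc n !
Σ-nCp*decrementedCoeff*denom n exact {len} r w = begin
  ℕ-Sum.Σ< len (λ p → (n C p) * decrementedCoeff n p r) * denom 1 r
    ≡⟨ ℕ-Sum.Σ<-distribʳ len (denom 1 r) _ ⟩
  ℕ-Sum.Σ< len (λ p → (n C p) * decrementedCoeff n p r * denom 1 r)
    ≡⟨ ℕ-Sum.Σ<-cong len (nCp*decrementedCoeff*denom n exact r w) ⟩
  ℕ-Sum.Σ< len (λ p → n ! * ((p + 1) * entry r p))
    ≡⟨ ℕ-Sum.Σ<-distribˡ len (n !) _ ⟨
  n ! * ℕ-Sum.Σ< len (λ p → (p + 1) * entry r p)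
    ≡⟨ cong (n ! *_) (trans (Σ-index*entry≡weight 1 r) w) ⟩
  n ! * suc n
    ≡⟨ *-comm (n !) (suc n) ⟩
  suc n !
    ∎
  where open ≡-Reasoning

-- Since div truncates, that denom 1 r divides n! is proved together with the recurrence.
coeff-recurrence< : ∀ n → (∀ {m} → m < suc n → CoeffExact m) → ∀ {len} (r : Vec ℕ len) → weight 1 r ≡ suc n →
                    coeff (suc n) r ≡ ℕ-Sum.Σ< len (λ p → (n C p) * decrementedCoeff n p r)
coeff-recurrence< n exact {len} r w =
  *≡⇒div≡ (ℕ-Sum.Σ< len _) (Σ-nCp*decrementedCoeff*denom n exact r w) (denom-positive 1 r)

coeff-exact : ∀ n → CoeffExact n
coeff-exact = <-rec CoeffExact exact
  where
    exact : ∀ n → (∀ {m} → m < n → CoeffExact m) → CoeffExact n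
    exact zero    _      r w = cong (λ d → 1 div d * d) (weight≡0⇒denom≡1 0 r w)
    exact (suc n) exact< r w = trans (cong (_* denom 1 r) (coeff-recurrence< n exact< r w))
                                     (Σ-nCp*decrementedCoeff*denom n exact< r w)

coeff-recurrence : ∀ n {len} (r : Vec ℕ len) → weight 1 r ≡ suc n →
                   coeff (suc n) r ≡ ℕ-Sum.Σ< len (λ p → (n C p) * decrementedCoeff n p r)
coeff-recurrence n = coeff-recurrence< n (λ _ → coeff-exact _)

n∸k+1+k≡1+n : ∀ {n k} → k ≤ n → n ∸ k + 1 + k ≡ suc n
n∸k+1+k≡1+n {n} {k} k≤n = begin
  n ∸ k + 1 + k   ≡⟨ +-assoc (n ∸ k) 1 k ⟩
  n ∸ k + suc k   ≡⟨ +-suc (n ∸ k) k ⟩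
  suc (n ∸ k + k) ≡⟨ cong suc (m∸n+n≡m k≤n) ⟩
  suc n           ∎
  where open ≡-Reasoning

n∸[n∸k+1+i]<k : ∀ {n k i} → k ≤ n → i < k → n ∸ (n ∸ k + 1 + i) < k
n∸[n∸k+1+i]<k {n} {k} {i} k≤n i<k = begin-strict
  n ∸ (n ∸ k + 1 + i)   ≤⟨ ∸-monoʳ-≤ n (m≤m+n (n ∸ k + 1) i) ⟩
  n ∸ (n ∸ k + 1)       ≡⟨ ∸-+-assoc n (n ∸ k) 1 ⟨
  n ∸ (n ∸ k) ∸ 1       ≡⟨ cong (_∸ 1) (m∸[m∸n]≡n k≤n) ⟩
  k ∸ 1                 <⟨ ∸-monoʳ-< z<s (≤-trans z<s i<k) ⟩
  k ∸ 0                 ∎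
  where open ≤-Reasoning

i<n∸k+1⇒k≤n∸i : ∀ {n k i} → k ≤ n → i < n ∸ k + 1 → k ≤ n ∸ i
i<n∸k+1⇒k≤n∸i {n} {k} {i} k≤n lt =
  m+n≤o⇒m≤o∸n k (≤-trans (≤-reflexive (+-comm k i)) (m≤o∸n⇒m+n≤o i k≤n i≤n∸k))
  where
    i≤n∸k : i ≤ n ∸ k
    i≤n∸k = ≤-pred (≤-trans lt (≤-reflexive (+-comm (n ∸ k) 1)))

module BellProperties {c ℓ} (R : CommutativeRing c ℓ) where
  module R = CommutativeRing R
  open R using (Carrier; _≈_; 0#; 1#; setoid) renaming (_+_ to _⊕_; _*_ to _⊗_)
  open Bell R
  open FiniteSum R.commutativeSemiring
  open import Relation.Binary.Reasoning.Setoid setoid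
  open import Algebra.Properties.CommutativeSemigroup R.+-commutativeSemigroup using (interchange)
  open import Algebra.Properties.CommutativeSemigroup R.*-commutativeSemigroup using () renaming (x∙yz≈y∙xz to x*yz≈y*xz)

  ·-congʳ : ∀ m {x y} → x ≈ y → m · x ≈ m · y
  ·-congʳ zero    eq = R.refl
  ·-congʳ (suc m) eq = R.+-cong eq (·-congʳ m eq)

  ·-zeroʳ : ∀ m → m · 0# ≈ 0#
  ·-zeroʳ zero    = R.refl
  ·-zeroʳ (suc m) = R.trans (R.+-identityˡ _) (·-zeroʳ m)

  ·-homo-+ : ∀ m n x → (m + n) · x ≈ m · x ⊕ n · x
  ·-homo-+ zero    n x = R.sym (R.+-identityˡ _)
  ·-homo-+ (suc m) n x = R.trans (R.+-congˡ (·-homo-+ m n x)) (R.sym (R.+-assoc _ _ _))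

  ·-assoc : ∀ m n x → (m * n) · x ≈ m · (n · x)
  ·-assoc zero    n x = R.refl
  ·-assoc (suc m) n x = R.trans (·-homo-+ n (m * n) x) (R.+-congˡ (·-assoc m n x))

  ·-distrib-⊕ : ∀ m x y → m · (x ⊕ y) ≈ m · x ⊕ m · y
  ·-distrib-⊕ zero    x y = R.sym (R.+-identityˡ 0#)
  ·-distrib-⊕ (suc m) x y = R.trans (R.+-congˡ (·-distrib-⊕ m x y)) (interchange x y _ _)

  ·-comm-⊗ : ∀ m x y → x ⊗ (m · y) ≈ m · (x ⊗ y)
  ·-comm-⊗ zero    x y = R.zeroʳ x
  ·-comm-⊗ (suc m) x y = R.trans (R.distribˡ x y _) (R.+-congˡ (·-comm-⊗ m x y))

  ·-⊗-zero : ∀ m x {y} → y ≈ 0# → m · (x ⊗ y) ≈ 0#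
  ·-⊗-zero m x y≈0 = R.trans (·-congʳ m (R.trans (R.*-congˡ y≈0) (R.zeroʳ x))) (·-zeroʳ m)

  ·-distribʳ-Σ< : ∀ n a v → ℕ-Sum.Σ< n a · v ≈ Σ< n (λ i → a i · v)
  ·-distribʳ-Σ< zero    a v = R.refl
  ·-distribʳ-Σ< (suc n) a v = R.trans (·-homo-+ (a 0) _ v) (R.+-congˡ (·-distribʳ-Σ< n (a ∘ suc) v))

  sumMap : ∀ {a} {A : Set a} → List A → (A → Carrier) → Carrier
  sumMap xs f = sumL (List.map f xs)

  module _ {a} {A : Set a} where
    sumMap-cong : ∀ (xs : List A) {f g} → (∀ x → f x ≈ g x) → sumMap xs f ≈ sumMap xs g
    sumMap-cong List.[]       eq = R.refl
    sumMap-cong (x List.∷ xs) eq = R.+-cong (eq x) (sumMap-cong xs eq)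

    sumMap-zero : ∀ (xs : List A) {f} → (∀ x → f x ≈ 0#) → sumMap xs f ≈ 0#
    sumMap-zero List.[]       eq = R.refl
    sumMap-zero (x List.∷ xs) eq = R.trans (R.+-cong (eq x) (sumMap-zero xs eq)) (R.+-identityˡ 0#)

    sumMap-⊕ : ∀ (xs : List A) f g → sumMap xs (λ x → f x ⊕ g x) ≈ sumMap xs f ⊕ sumMap xs g
    sumMap-⊕ List.[]       f g = R.sym (R.+-identityˡ 0#)
    sumMap-⊕ (x List.∷ xs) f g = R.trans (R.+-congˡ (sumMap-⊕ xs f g)) (interchange _ _ _ _)

    sumMap-⊗ : ∀ (xs : List A) y f → sumMap xs (λ x → y ⊗ f x) ≈ y ⊗ sumMap xs f
    sumMap-⊗ List.[]       y f = R.sym (R.zeroʳ y)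
    sumMap-⊗ (x List.∷ xs) y f = R.trans (R.+-congˡ (sumMap-⊗ xs y f)) (R.sym (R.distribˡ y _ _))

    sumMap-· : ∀ (xs : List A) m f → sumMap xs (λ x → m · f x) ≈ m · sumMap xs f
    sumMap-· List.[]       m f = R.sym (·-zeroʳ m)
    sumMap-· (x List.∷ xs) m f = R.trans (R.+-congˡ (sumMap-· xs m f)) (R.sym (·-distrib-⊕ m _ _))

    sumMap-++ : ∀ (xs ys : List A) f → sumMap (xs List.++ ys) f ≈ sumMap xs f ⊕ sumMap ys f
    sumMap-++ List.[]       ys f = R.sym (R.+-identityˡ _)
    sumMap-++ (x List.∷ xs) ys f = R.trans (R.+-congˡ (sumMap-++ xs ys f)) (R.sym (R.+-assoc _ _ _))

  sumMap-concatMap : ∀ {a b} {A : Set a} {B : Set b} (xs : List A) (g : A → List B) f →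
                     sumMap (concatMap g xs) f ≈ sumMap xs (λ x → sumMap (g x) f)
  sumMap-concatMap List.[]       g f = R.refl
  sumMap-concatMap (x List.∷ xs) g f = R.trans (sumMap-++ (g x) (concatMap g xs) f) (R.+-congˡ (sumMap-concatMap xs g f))

  sumMap-map : ∀ {a b} {A : Set a} {B : Set b} (xs : List A) (g : A → B) f → sumMap (List.map g xs) f ≡ sumMap xs (f ∘ g)
  sumMap-map List.[]       g f = refl
  sumMap-map (x List.∷ xs) g f = cong (f (g x) ⊕_) (sumMap-map xs g f)

  sumMap-applyUpTo : ∀ (f : ℕ → Carrier) g n → sumMap (applyUpTo g n) f ≡ Σ< n (f ∘ g)
  sumMap-applyUpTo f g zero    = refl
  sumMap-applyUpTo f g (suc n) = cong (f (g 0) ⊕_) (sumMap-applyUpTo f (g ∘ suc) n)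

  sumFromTo1≡Σ< : ∀ n f → sumFromTo 1 n f ≡ Σ< n (f ∘ suc)
  sumFromTo1≡Σ< n f = sumMap-applyUpTo (f ∘ suc) (λ i → i) n

  sumFromTo1-cong< : ∀ n f g → (∀ i → i < n → f (suc i) ≈ g (suc i)) → sumFromTo 1 n f ≈ sumFromTo 1 n g
  sumFromTo1-cong< n f g eq = begin
    sumFromTo 1 n f   ≡⟨ sumFromTo1≡Σ< n f ⟩
    Σ< n (f ∘ suc)    ≈⟨ Σ<-cong< n eq ⟩
    Σ< n (g ∘ suc)    ≡⟨ sumFromTo1≡Σ< n g ⟨
    sumFromTo 1 n g   ∎

  Σᵛ : (len b : ℕ) → (Vec ℕ len → Carrier) → Carrier
  Σᵛ len b = sumMap (allVecs len b)

  Σᵛ-cong : ∀ len b {f g} → (∀ r → f r ≈ g r) → Σᵛ len b f ≈ Σᵛ len b g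
  Σᵛ-cong len b = sumMap-cong (allVecs len b)

  Σᵛ-zero : ∀ len b {f} → (∀ r → f r ≈ 0#) → Σᵛ len b f ≈ 0#
  Σᵛ-zero len b = sumMap-zero (allVecs len b)

  Σᵛ-suc : ∀ len b f → Σᵛ (suc len) b f ≈ Σ< (suc b) (λ x → Σᵛ len b (f ∘ (x ∷_)))
  Σᵛ-suc len b f = begin
    sumMap (concatMap (λ x → List.map (x ∷_) (allVecs len b)) (upTo (suc b))) f
      ≈⟨ sumMap-concatMap (upTo (suc b)) (λ x → List.map (x ∷_) (allVecs len b)) f ⟩
    sumMap (upTo (suc b)) (λ x → sumMap (List.map (x ∷_) (allVecs len b)) f)
      ≈⟨ sumMap-cong (upTo (suc b)) (λ x → R.reflexive (sumMap-map (allVecs len b) (x ∷_) f)) ⟩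
    sumMap (upTo (suc b)) (λ x → Σᵛ len b (f ∘ (x ∷_)))
      ≡⟨ sumMap-applyUpTo (λ x → Σᵛ len b (f ∘ (x ∷_))) (λ i → i) (suc b) ⟩
    Σ< (suc b) (λ x → Σᵛ len b (f ∘ (x ∷_)))
      ∎

  Σᵛ-Σ< : ∀ len b n (g : ℕ → Vec ℕ len → Carrier) →
          Σᵛ len b (λ r → Σ< n (λ i → g i r)) ≈ Σ< n (λ i → Σᵛ len b (g i))
  Σᵛ-Σ< len b zero    g = Σᵛ-zero len b (λ _ → R.refl)
  Σᵛ-Σ< len b (suc n) g = R.trans (sumMap-⊕ (allVecs len b) (g 0) _) (R.+-congˡ (Σᵛ-Σ< len b n (g ∘ suc)))

  Σᵛ-raiseBound : ∀ len b d f → (∀ r → Any (b <_) r → f r ≈ 0#) → Σᵛ len (b + d) f ≈ Σᵛ len b f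
  Σᵛ-raiseBound zero      b d f _    = R.refl
  Σᵛ-raiseBound (suc len) b d f high = begin
    Σᵛ (suc len) (b + d) f
      ≈⟨ Σᵛ-suc len (b + d) f ⟩
    Σ< (suc b + d) (λ x → Σᵛ len (b + d) (f ∘ (x ∷_)))
      ≈⟨ Σ<-split (suc b) d (λ x → Σᵛ len (b + d) (f ∘ (x ∷_))) ⟩
    Σ< (suc b) (λ x → Σᵛ len (b + d) (f ∘ (x ∷_))) ⊕ Σ< d (λ i → Σᵛ len (b + d) (f ∘ (suc b + i ∷_)))
      ≈⟨ R.+-cong (Σ<-cong (suc b) (λ x → Σᵛ-raiseBound len b d (f ∘ (x ∷_)) (λ r e → high (x ∷ r) (there e))))
                  (Σ<-zero d (λ i _ → Σᵛ-zero len (b + d) (λ r → high _ (here (s≤s (m≤m+n b i)))))) ⟩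
    Σ< (suc b) (λ x → Σᵛ len b (f ∘ (x ∷_))) ⊕ 0#
      ≈⟨ R.+-identityʳ _ ⟩
    Σ< (suc b) (λ x → Σᵛ len b (f ∘ (x ∷_)))
      ≈⟨ Σᵛ-suc len b f ⟨
    Σᵛ (suc len) b f
      ∎

  Σᵛ-++ : ∀ l₁ l₂ b f → Σᵛ (l₁ + l₂) b f ≈ Σᵛ l₁ b (λ r → Σᵛ l₂ b (λ s → f (r ++ s)))
  Σᵛ-++ zero     l₂ b f = R.sym (R.+-identityʳ _)
  Σᵛ-++ (suc l₁) l₂ b f = begin
    Σᵛ (suc (l₁ + l₂)) b f
      ≈⟨ Σᵛ-suc (l₁ + l₂) b f ⟩
    Σ< (suc b) (λ x → Σᵛ (l₁ + l₂) b (f ∘ (x ∷_)))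
      ≈⟨ Σ<-cong (suc b) (λ x → Σᵛ-++ l₁ l₂ b (f ∘ (x ∷_))) ⟩
    Σ< (suc b) (λ x → Σᵛ l₁ b (λ r → Σᵛ l₂ b (λ s → f (x ∷ r ++ s))))
      ≈⟨ Σᵛ-suc l₁ b _ ⟨
    Σᵛ (suc l₁) b (λ r → Σᵛ l₂ b (λ s → f (r ++ s)))
      ∎

  Σᵛ-onlyZeroVector : ∀ d b f → (∀ s → Any (0 <_) s → f s ≈ 0#) → Σᵛ d b f ≈ f (replicate d 0)
  Σᵛ-onlyZeroVector zero    b f _   = R.+-identityʳ _
  Σᵛ-onlyZeroVector (suc d) b f pos = begin
    Σᵛ (suc d) b f
      ≈⟨ Σᵛ-suc d b f ⟩
    Σᵛ d b (f ∘ (0 ∷_)) ⊕ Σ< b (λ x → Σᵛ d b (f ∘ (suc x ∷_)))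
      ≈⟨ R.+-cong (Σᵛ-onlyZeroVector d b (f ∘ (0 ∷_)) (λ s e → pos (0 ∷ s) (there e)))
                  (Σ<-zero b (λ x _ → Σᵛ-zero d b (λ s → pos _ (here z<s)))) ⟩
    f (replicate (suc d) 0) ⊕ 0#
      ≈⟨ R.+-identityʳ _ ⟩
    f (replicate (suc d) 0)
      ∎

  -- Decrementing entry p maps the vectors with that entry positive onto those with that entry
  -- below b, so h has to vanish on the vectors it misses.
  Σᵛ-atDecrement : ∀ len b p h → p < len → (∀ t → entry t p ≡ b → h t ≈ 0#) →
                   Σᵛ len b (atDecrement 0# p h) ≈ Σᵛ len b h
  Σᵛ-atDecrement (suc len) b zero h _ top = begin
    Σᵛ (suc len) b (atDecrement 0# zero h)
      ≈⟨ Σᵛ-suc len b _ ⟩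
    Σᵛ len b (λ _ → 0#) ⊕ Σ< b (λ x → Σᵛ len b (h ∘ (x ∷_)))
      ≈⟨ R.+-congʳ (Σᵛ-zero len b (λ _ → R.refl)) ⟩
    0# ⊕ Σ< b (λ x → Σᵛ len b (h ∘ (x ∷_)))
      ≈⟨ R.+-comm _ _ ⟩
    Σ< b (λ x → Σᵛ len b (h ∘ (x ∷_))) ⊕ 0#
      ≈⟨ R.+-congˡ (Σᵛ-zero len b (λ r → top (b ∷ r) refl)) ⟨
    Σ< b (λ x → Σᵛ len b (h ∘ (x ∷_))) ⊕ Σᵛ len b (h ∘ (b ∷_))
      ≈⟨ Σ<-last b _ ⟨
    Σ< (suc b) (λ x → Σᵛ len b (h ∘ (x ∷_)))
      ≈⟨ Σᵛ-suc len b h ⟨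
    Σᵛ (suc len) b h
      ∎
  Σᵛ-atDecrement (suc len) b (suc p) h (s≤s p<len) top = begin
    Σᵛ (suc len) b (atDecrement 0# (suc p) h)
      ≈⟨ Σᵛ-suc len b _ ⟩
    Σ< (suc b) (λ x → Σᵛ len b (atDecrement 0# p (h ∘ (x ∷_))))
      ≈⟨ Σ<-cong (suc b) (λ x → Σᵛ-atDecrement len b p (h ∘ (x ∷_)) p<len (λ t → top (x ∷ t))) ⟩
    Σ< (suc b) (λ x → Σᵛ len b (h ∘ (x ∷_)))
      ≈⟨ Σᵛ-suc len b h ⟨
    Σᵛ (suc len) b h
      ∎

  module _ (X : ℕ → Carrier) where
    mono-decrementAt : ∀ {len} o p (r : Vec ℕ len) {y} → entry r p ≡ suc y →
                       mono X o r ≈ X (p + o) ⊗ mono X o (decrementAt p r)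
    mono-decrementAt o zero    (suc x ∷ r) eq = R.*-assoc (X o) (X o ^ x) _
    mono-decrementAt o (suc p) (x ∷ r) eq = begin
      (X o ^ x) ⊗ mono X (suc o) r
        ≈⟨ R.*-congˡ (mono-decrementAt (suc o) p r eq) ⟩
      (X o ^ x) ⊗ (X (p + suc o) ⊗ mono X (suc o) (decrementAt p r))
        ≡⟨ cong (λ q → (X o ^ x) ⊗ (X q ⊗ mono X (suc o) (decrementAt p r))) (+-suc p o) ⟩
      (X o ^ x) ⊗ (X (suc p + o) ⊗ mono X (suc o) (decrementAt p r))
        ≈⟨ x*yz≈y*xz _ _ _ ⟩
      X (suc p + o) ⊗ ((X o ^ x) ⊗ mono X (suc o) (decrementAt p r))
        ∎

    mono-padding : ∀ {len} d o (r : Vec ℕ len) → mono X o (r ++ replicate d 0) ≈ mono X o r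
    mono-padding zero    o []      = R.refl
    mono-padding (suc d) o []      = R.trans (R.*-identityˡ _) (mono-padding d (suc o) [])
    mono-padding d       o (x ∷ r) = R.*-congˡ (mono-padding d (suc o) r)

    -- Definitionally the summand of B m (suc k) X.
    bellTerm : ℕ → ℕ → ∀ {len} → Vec ℕ len → Carrier
    bellTerm m k r = if ⌊ size r ≟ k ⌋ ∧ ⌊ weight 1 r ≟ m ⌋ then coeff m r · mono X 1 r else 0#

    bellTerm-inside : ∀ m k {len} (r : Vec ℕ len) → size r ≡ k → weight 1 r ≡ m → bellTerm m k r ≡ coeff m r · mono X 1 r
    bellTerm-inside m k r s w with size r ≟ k | weight 1 r ≟ m
    ... | yes _ | yes _ = refl
    ... | no ¬s | _     = ⊥-elim (¬s s)
    ... | yes _ | no ¬w = ⊥-elim (¬w w)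

    bellTerm-outside : ∀ m k {len} (r : Vec ℕ len) → ¬ (size r ≡ k × weight 1 r ≡ m) → bellTerm m k r ≡ 0#
    bellTerm-outside m k r out with size r ≟ k | weight 1 r ≟ m
    ... | yes s | yes w = ⊥-elim (out (s , w))
    ... | yes _ | no _  = refl
    ... | no _  | _     = refl

    bellTerm-heavy : ∀ m k {len} (r : Vec ℕ len) → m < weight 1 r → bellTerm m k r ≈ 0#
    bellTerm-heavy m k r m<w = R.reflexive (bellTerm-outside m k r (λ (_ , w) → <⇒≢ m<w (sym w)))

    bellTerm-padding : ∀ m k {len} d (r : Vec ℕ len) → bellTerm m k (r ++ replicate d 0) ≈ bellTerm m k r
    bellTerm-padding m k d r with size r ≟ k ×-dec weight 1 r ≟ m
    ... | yes (s , w) = begin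
      bellTerm m k (r ++ z)                  ≡⟨ bellTerm-inside m k (r ++ z) (trans (size-padding d r) s)
                                                                             (trans (weight-padding d 1 r) w) ⟩
      coeff m (r ++ z) · mono X 1 (r ++ z)   ≡⟨ cong (λ q → ((m !) div q) · mono X 1 (r ++ z)) (denom-padding d 1 r) ⟩
      coeff m r · mono X 1 (r ++ z)          ≈⟨ ·-congʳ (coeff m r) (mono-padding d 1 r) ⟩
      coeff m r · mono X 1 r                 ≡⟨ bellTerm-inside m k r s w ⟨
      bellTerm m k r                         ∎
      where z = replicate d 0
    ... | no out = R.reflexive (trans (bellTerm-outside m k (r ++ replicate d 0) out′) (sym (bellTerm-outside m k r out)))
      where
        out′ : ¬ (size (r ++ replicate d 0) ≡ k × weight 1 (r ++ replicate d 0) ≡ m)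
        out′ (s , w) = out (trans (sym (size-padding d r)) s , trans (sym (weight-padding d 1 r)) w)

    bellSum : ℕ → ℕ → Carrier
    bellSum m k = Σᵛ m m (bellTerm m k)

    bellSum-vanish : ∀ m k → m < k → bellSum m k ≈ 0#
    bellSum-vanish m k m<k = Σᵛ-zero m m (λ r → R.reflexive (bellTerm-outside m k r
      (λ (s , w) → <⇒≱ m<k (subst₂ _≤_ s w (size≤weight 0 r)))))

    bellSum≈B : ∀ m k → bellSum m k ≈ B m k X
    bellSum≈B zero    zero    = R.trans (R.+-identityʳ _) (R.+-identityʳ _)
    bellSum≈B (suc m) zero    = Σᵛ-zero (suc m) (suc m) (λ r → R.reflexive (bellTerm-outside (suc m) 0 r
      (λ (s , w) → 0≢1+n (trans (sym (size≡0⇒weight≡0 1 r s)) w))))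
    bellSum≈B zero    (suc k) = bellSum-vanish 0 (suc k) z<s
    bellSum≈B (suc m) (suc k) with suc m <? suc k
    ... | yes m<k = bellSum-vanish (suc m) (suc k) m<k
    ... | no _    = R.refl

    -- Longer vectors and larger entries only add exponent vectors of weight above m.
    bellSum-resize : ∀ m n k → m ≤ n → Σᵛ n n (bellTerm m k) ≈ bellSum m k
    bellSum-resize m n k m≤n = subst (λ n → Σᵛ n n (bellTerm m k) ≈ bellSum m k) (m+[n∸m]≡n m≤n) (padded (n ∸ m))
      where
        padded : ∀ d → Σᵛ (m + d) (m + d) (bellTerm m k) ≈ bellSum m k
        padded d = begin
          Σᵛ (m + d) (m + d) (bellTerm m k)
            ≈⟨ Σᵛ-raiseBound (m + d) m d (bellTerm m k) (λ r e → bellTerm-heavy m k r (any>⇒<weight 0 e)) ⟩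
          Σᵛ (m + d) m (bellTerm m k)
            ≈⟨ Σᵛ-++ m d m (bellTerm m k) ⟩
          Σᵛ m m (λ r → Σᵛ d m (λ s → bellTerm m k (r ++ s)))
            ≈⟨ Σᵛ-cong m m (λ r → R.trans
                 (Σᵛ-onlyZeroVector d m (λ s → bellTerm m k (r ++ s))
                   (λ s pos → bellTerm-heavy m k (r ++ s) (positive-tail⇒<weight r s pos)))
                 (bellTerm-padding m k d r)) ⟩
          bellSum m k
            ∎

    splitTerm : ℕ → ℕ → ℕ → ∀ {len} → Vec ℕ len → Carrier
    splitTerm n k p r = (n C p) · (X (suc p) ⊗ atDecrement 0# p (bellTerm (n ∸ p) k) r)

    splitTerm-entry0 : ∀ n k p {len} (r : Vec ℕ len) → entry r p ≡ 0 → splitTerm n k p r ≈ 0#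
    splitTerm-entry0 n k p r eq = ·-⊗-zero (n C p) (X (suc p)) (R.reflexive (atDecrement-zero 0# p (bellTerm (n ∸ p) k) r eq))

    splitTerm-inside : ∀ n k p {len} (r : Vec ℕ len) → size r ≡ suc k → weight 1 r ≡ suc n →
                       splitTerm n k p r ≈ ((n C p) * decrementedCoeff n p r) · mono X 1 r
    splitTerm-inside n k p r s w with entry r p in eq
    ... | zero = R.trans (splitTerm-entry0 n k p r eq) (R.reflexive (cong (_· mono X 1 r) (sym
                   (trans (cong ((n C p) *_) (atDecrement-zero 0 p (coeff (n ∸ p)) r eq)) (*-zeroʳ (n C p))))))
    ... | suc y = begin
      (n C p) · (X (suc p) ⊗ atDecrement 0# p (bellTerm (n ∸ p) k) r)
        ≡⟨ cong (λ t → (n C p) · (X (suc p) ⊗ t)) (atDecrement-suc 0# p (bellTerm (n ∸ p) k) r eq) ⟩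
      (n C p) · (X (suc p) ⊗ bellTerm (n ∸ p) k r′)
        ≡⟨ cong (λ t → (n C p) · (X (suc p) ⊗ t)) (bellTerm-inside (n ∸ p) k r′ s′ w′) ⟩
      (n C p) · (X (suc p) ⊗ (a · mono X 1 r′))
        ≈⟨ ·-congʳ (n C p) (·-comm-⊗ a (X (suc p)) (mono X 1 r′)) ⟩
      (n C p) · (a · (X (suc p) ⊗ mono X 1 r′))
        ≈⟨ ·-assoc (n C p) a _ ⟨
      ((n C p) * a) · (X (suc p) ⊗ mono X 1 r′)
        ≈⟨ ·-congʳ ((n C p) * a) mono≈ ⟨
      ((n C p) * a) · mono X 1 r
        ≡⟨ cong (λ c → ((n C p) * c) · mono X 1 r) (atDecrement-suc 0 p (coeff (n ∸ p)) r eq) ⟨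
      ((n C p) * decrementedCoeff n p r) · mono X 1 r
        ∎
      where
        r′ = decrementAt p r
        a = coeff (n ∸ p) r′
        s′ : size r′ ≡ k
        s′ = suc-injective (trans (sym (size-decrementAt p r eq)) s)
        w′ : weight 1 r′ ≡ n ∸ p
        w′ = proj₂ (weight≡⇒weight-decrementAt≡ p r eq w)
        mono≈ : mono X 1 r ≈ X (suc p) ⊗ mono X 1 r′
        mono≈ = R.trans (mono-decrementAt 1 p r eq) (R.*-congʳ (R.reflexive (cong X (+-comm p 1))))

    splitTerm-outside : ∀ n k p {len} (r : Vec ℕ len) → ¬ (size r ≡ suc k × weight 1 r ≡ suc n) → splitTerm n k p r ≈ 0#
    splitTerm-outside n k p r out with entry r p in eq | p ≤? n
    ... | zero  | _       = splitTerm-entry0 n k p r eq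
    ... | suc y | no p≰n  =
      R.reflexive (cong (_· (X (suc p) ⊗ atDecrement 0# p (bellTerm (n ∸ p) k) r)) (k>n⇒nCk≡0 (≰⇒> p≰n)))
    ... | suc y | yes p≤n = ·-⊗-zero (n C p) (X (suc p)) (R.reflexive
      (trans (atDecrement-suc 0# p (bellTerm (n ∸ p) k) r eq) (bellTerm-outside (n ∸ p) k (decrementAt p r) out′)))
      where
        out′ : ¬ (size (decrementAt p r) ≡ k × weight 1 (decrementAt p r) ≡ n ∸ p)
        out′ (s , w) = out (trans (size-decrementAt p r eq) (cong suc s) , weight-decrementAt≡⇒weight≡ p r eq p≤n w)

    bellTerm-split : ∀ n k {len} (r : Vec ℕ len) → bellTerm (suc n) (suc k) r ≈ Σ< len (λ p → splitTerm n k p r)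
    bellTerm-split n k {len} r with size r ≟ suc k ×-dec weight 1 r ≟ suc n
    ... | yes (s , w) = begin
      bellTerm (suc n) (suc k) r
        ≡⟨ bellTerm-inside (suc n) (suc k) r s w ⟩
      coeff (suc n) r · mono X 1 r
        ≡⟨ cong (_· mono X 1 r) (coeff-recurrence n r w) ⟩
      ℕ-Sum.Σ< len (λ p → (n C p) * decrementedCoeff n p r) · mono X 1 r
        ≈⟨ ·-distribʳ-Σ< len (λ p → (n C p) * decrementedCoeff n p r) (mono X 1 r) ⟩
      Σ< len (λ p → ((n C p) * decrementedCoeff n p r) · mono X 1 r)
        ≈⟨ Σ<-cong len (λ p → splitTerm-inside n k p r s w) ⟨
      Σ< len (λ p → splitTerm n k p r)
        ∎
    ... | no out = R.trans (R.reflexive (bellTerm-outside (suc n) (suc k) r out))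
                           (R.sym (Σ<-zero len (λ p _ → splitTerm-outside n k p r out)))

    bellSum-recurrence : ∀ n k → bellSum (suc n) (suc k) ≈ Σ< (suc n) (λ p → (n C p) · (X (suc p) ⊗ bellSum (n ∸ p) k))
    bellSum-recurrence n k = begin
      Σᵛ N N (bellTerm N (suc k))
        ≈⟨ Σᵛ-cong N N (bellTerm-split n k) ⟩
      Σᵛ N N (λ r → Σ< N (λ p → splitTerm n k p r))
        ≈⟨ Σᵛ-Σ< N N N (λ p r → splitTerm n k p r) ⟩
      Σ< N (λ p → Σᵛ N N (splitTerm n k p))
        ≈⟨ Σ<-cong N pull ⟩
      Σ< N (λ p → (n C p) · (X (suc p) ⊗ Σᵛ N N (atDecrement 0# p (bellTerm (n ∸ p) k))))
        ≈⟨ Σ<-cong< N (λ p p<N → ·-congʳ (n C p) (R.*-congˡ {X (suc p)} (shift p p<N))) ⟩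
      Σ< N (λ p → (n C p) · (X (suc p) ⊗ bellSum (n ∸ p) k))
        ∎
      where
        N = suc n
        pull : ∀ p → Σᵛ N N (splitTerm n k p) ≈ (n C p) · (X (suc p) ⊗ Σᵛ N N (atDecrement 0# p (bellTerm (n ∸ p) k)))
        pull p = R.trans (sumMap-· (allVecs N N) (n C p) (λ r → X (suc p) ⊗ atDecrement 0# p (bellTerm (n ∸ p) k) r))
                         (·-congʳ (n C p) (sumMap-⊗ (allVecs N N) (X (suc p)) (atDecrement 0# p (bellTerm (n ∸ p) k))))
        shift : ∀ p → p < N → Σᵛ N N (atDecrement 0# p (bellTerm (n ∸ p) k)) ≈ bellSum (n ∸ p) k
        shift p p<N = R.trans
          (Σᵛ-atDecrement N N p (bellTerm (n ∸ p) k) p<N (λ t eq → bellTerm-heavy (n ∸ p) k t (entry≡⇒∸<weight p t eq)))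
          (bellSum-resize (n ∸ p) N k (≤-trans (m∸n≤m n p) (n≤1+n n)))

    B-recurrence : ∀ n k → k ≤ n →
                   B (suc n) (suc k) X ≈ sumFromTo 1 (n ∸ k + 1) (λ j → (n C (j ∸ 1)) · (X j ⊗ B (suc n ∸ j) k X))
    B-recurrence n k k≤n = begin
      B (suc n) (suc k) X              ≈⟨ bellSum≈B (suc n) (suc k) ⟨
      bellSum (suc n) (suc k)          ≈⟨ bellSum-recurrence n k ⟩
      Σ< (suc n) g                     ≡⟨ cong (λ m → Σ< m g) (n∸k+1+k≡1+n k≤n) ⟨
      Σ< (A + k) g                     ≈⟨ Σ<-split A k g ⟩
      Σ< A g ⊕ Σ< k (λ i → g (A + i))  ≈⟨ R.+-congˡ (Σ<-zero k beyond) ⟩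
      Σ< A g ⊕ 0#                      ≈⟨ R.+-identityʳ _ ⟩
      Σ< A g                           ≈⟨ Σ<-cong A (λ i → ·-congʳ (n C i) (R.*-congˡ (bellSum≈B (n ∸ i) k))) ⟩
      Σ< A (term ∘ suc)                ≡⟨ sumFromTo1≡Σ< A term ⟨
      sumFromTo 1 A term               ∎
      where
        A = n ∸ k + 1
        term = λ j → (n C (j ∸ 1)) · (X j ⊗ B (suc n ∸ j) k X)
        g = λ p → (n C p) · (X (suc p) ⊗ bellSum (n ∸ p) k)
        beyond : ∀ i → i < k → g (A + i) ≈ 0#
        beyond i i<k = ·-⊗-zero (n C (A + i)) (X (suc (A + i))) (bellSum-vanish (n ∸ (A + i)) k (n∸[n∸k+1+i]<k k≤n i<k))

    B-n1 : ∀ n → B (suc n) 1 X ≈ X (suc n)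
    B-n1 n = begin
      B (suc n) 1 X                           ≈⟨ B-recurrence n 0 z≤n ⟩
      sumFromTo 1 (n + 1) term                ≡⟨ sumFromTo1≡Σ< (n + 1) term ⟩
      Σ< (n + 1) (term ∘ suc)                 ≡⟨ cong (λ m → Σ< m (term ∘ suc)) (+-comm n 1) ⟩
      Σ< (suc n) (term ∘ suc)                 ≈⟨ Σ<-last n (term ∘ suc) ⟩
      Σ< n (term ∘ suc) ⊕ term (suc n)        ≈⟨ R.+-congʳ (Σ<-zero n (λ i i<n → ·-⊗-zero (n C i) (X (suc i)) (B0 (m<n⇒0<n∸m i<n)))) ⟩
      0# ⊕ term (suc n)                       ≈⟨ R.+-identityˡ _ ⟩
      (n C n) · (X (suc n) ⊗ B (n ∸ n) 0 X)   ≡⟨ cong₂ (λ c m → c · (X (suc n) ⊗ B m 0 X)) (nCn≡1 n) (n∸n≡0 n) ⟩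
      1 · (X (suc n) ⊗ 1#)                    ≈⟨ R.+-identityʳ _ ⟩
      X (suc n) ⊗ 1#                          ≈⟨ R.*-identityʳ _ ⟩
      X (suc n)                               ∎
      where
        term = λ j → (n C (j ∸ 1)) · (X j ⊗ B (suc n ∸ j) 0 X)
        B0 : ∀ {m} → 0 < m → B m 0 X ≈ 0#
        B0 {suc m} _ = R.refl

  recurrenceSum : (ℕ → ℕ → Carrier) → ℕ → ℕ → Carrier
  recurrenceSum P n k = sumFromTo 1 (n ∸ k + 1) (λ j → ((n ∸ 1) C (j ∸ 1)) · (P j 1 ⊗ P (n ∸ j) (k ∸ 1)))

  recurrenceSum-cong : ∀ P P′ n k →
    (∀ i → i < n ∸ k + 1 → P (suc i) 1 ≈ P′ (suc i) 1 × P (n ∸ suc i) (k ∸ 1) ≈ P′ (n ∸ suc i) (k ∸ 1)) →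
    recurrenceSum P n k ≈ recurrenceSum P′ n k
  recurrenceSum-cong P P′ n k agree =
    sumFromTo1-cong< (n ∸ k + 1)
    (λ j → ((n ∸ 1) C (j ∸ 1)) · (P j 1 ⊗ P (n ∸ j) (k ∸ 1)))
    (λ j → ((n ∸ 1) C (j ∸ 1)) · (P′ j 1 ⊗ P′ (n ∸ j) (k ∸ 1)))
    (λ i lt → ·-congʳ ((n ∸ 1) C i) (R.*-cong (proj₁ (agree i lt)) (proj₂ (agree i lt))))

  bell-recurrence : ∀ H → BellRecurrence (λ n k → B n k H)
  bell-recurrence H (suc n) (suc k) _ (s≤s k≤n) = begin
    B (suc n) (suc k) H
      ≈⟨ B-recurrence H n k k≤n ⟩
    sumFromTo 1 (n ∸ k + 1) (λ j → (n C (j ∸ 1)) · (H j ⊗ B (suc n ∸ j) k H))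
      ≈⟨ sumFromTo1-cong< (n ∸ k + 1)
           (λ j → (n C (j ∸ 1)) · (H j ⊗ B (suc n ∸ j) k H))
           (λ j → (n C (j ∸ 1)) · (B j 1 H ⊗ B (suc n ∸ j) k H))
           (λ i _ → ·-congʳ (n C i) (R.*-congʳ (R.sym (B-n1 H i)))) ⟩
    recurrenceSum (λ n k → B n k H) (suc n) (suc k)
      ∎

  BellRecurrence-resp : ∀ {P P′} → (∀ n k → k ≤ n → P n k ≈ P′ n k) → BellRecurrence P → BellRecurrence P′
  BellRecurrence-resp {P} {P′} agree rec (suc n) (suc k) _ (s≤s k≤n) = begin
    P′ (suc n) (suc k)                ≈⟨ agree (suc n) (suc k) (s≤s k≤n) ⟨
    P (suc n) (suc k)                 ≈⟨ rec (suc n) (suc k) (s≤s z≤n) (s≤s k≤n) ⟩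
    recurrenceSum P (suc n) (suc k)   ≈⟨ recurrenceSum-cong P P′ (suc n) (suc k) (λ i lt →
                                           agree (suc i) 1 (s≤s z≤n) , agree (n ∸ i) k (i<n∸k+1⇒k≤n∸i k≤n lt)) ⟩
    recurrenceSum P′ (suc n) (suc k)  ∎

  module _ (Q : ℕ → ℕ → Carrier) (Q₀₀ : Q 0 0 ≈ 1#) (Qₘ₀ : ∀ m → Q (suc m) 0 ≈ 0#) where
    column0 : ∀ H n → Q n 0 ≈ B n 0 H
    column0 H zero    = Q₀₀
    column0 H (suc m) = Qₘ₀ m

    representable⇒recurrence : BRepresentable Q → BellRecurrence Q
    representable⇒recurrence (H , representation) = BellRecurrence-resp agree (bell-recurrence H)
      where
        agree : ∀ n k → k ≤ n → B n k H ≈ Q n k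
        agree n zero    _   = R.sym (column0 H n)
        agree n (suc k) k<n = R.sym (representation n (suc k) (s≤s z≤n) k<n)

    recurrence⇒representable : BellRecurrence Q → BRepresentable Q
    recurrence⇒representable rec = H , <-rec _ representation
      where
        H = λ j → Q j 1
        representation : ∀ n → (∀ {m} → m < n → ∀ k → 1 ≤ k → k ≤ m → Q m k ≈ B m k H) →
                         ∀ k → 1 ≤ k → k ≤ n → Q n k ≈ B n k H
        representation (suc n) below (suc k) _ (s≤s k≤n) = begin
          Q (suc n) (suc k)                                 ≈⟨ rec (suc n) (suc k) (s≤s z≤n) (s≤s k≤n) ⟩
          recurrenceSum Q (suc n) (suc k)                   ≈⟨ recurrenceSum-cong Q (λ n k → B n k H) (suc n) (suc k) (λ i lt →
                                                                 R.sym (B-n1 H i) , shorter k k≤n i lt) ⟩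
          recurrenceSum (λ n k → B n k H) (suc n) (suc k)   ≈⟨ bell-recurrence H (suc n) (suc k) (s≤s z≤n) (s≤s k≤n) ⟨
          B (suc n) (suc k) H                               ∎
          where
            shorter : ∀ k → k ≤ n → ∀ i → i < n ∸ k + 1 → Q (n ∸ i) k ≈ B (n ∸ i) k H
            shorter zero    _   i _  = column0 H (n ∸ i)
            shorter (suc k) k≤n i lt = below (s≤s (m∸n≤m n i)) (suc k) (s≤s z≤n) (i<n∸k+1⇒k≤n∸i k≤n lt)

proposition5p4 : ∀ {c ℓ} (R : CommutativeRing c ℓ) → (Q : ℕ → ℕ → CommutativeRing.Carrier R) →
    CommutativeRing._≈_ R (Q 0 0) (CommutativeRing.1# R) →
    (∀ m → CommutativeRing._≈_ R (Q (suc m) 0) (CommutativeRing.0# R)) →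
    (Bell.BRepresentable R Q ⇔ Bell.BellRecurrence R Q)
proposition5p4 R Q Q₀₀ Qₘ₀ =
  mk⇔ (representable⇒recurrence Q Q₀₀ Qₘ₀) (recurrence⇒representable Q Q₀₀ Qₘ₀)
  where open BellProperties R
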